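{- Let $F$ be a periodic fabric of order greater than $4$, and suppose the strands of $F$ are coloured by thin striping in such a way that the colouring is perfect. Suppose that the side-preserving subgroup $H_1$ of the symmetry group of $F$ is generated by side-preserving glide-reflections and is transitive on the set of strands of $F$. Then the pattern of this coloured fabric, regarded as a design, is the design of an isonemal prefabric that falls apart.
   Context: A prefabric consists of two layers of parallel strands of unit width in a plane $E$: the warps (vertical) and the wefts (horizontal); each warp crosses each weft in a unit square cell, and in each cell one of the two crossing strands is specified as uppermost. All prefabrics considered are periodic: invariant under two linearly independent translations. A fabric is a prefabric that hangs together, i.e. does not fall apart; a prefabric falls apart if there is a nonempty proper subset $S$ of its strands that can be lifted off the rest, i.e. at every cell where a strand of $S$ crosses a strand not in $S$, the strand of $S$ is uppermost. The design of a prefabric is the array of cells, viewed from a fixed side (the obverse), in which a cell is dark if the warp is uppermost there and pale if the weft is uppermost; conversely any dark/pale colouring of the cells is the design of a unique prefabric (warp uppermost exactly in the dark cells). A symmetry of a prefabric is an isometry $\sigma$ of the plane mapping the grid of cells (hence the set of strands) to itself, either side-preserving or side-reversing (combined with the reflection $\tau$ in the plane $E$ exchanging the two sides), such that for every cell $c$ the design colour of $\sigma(c)$ equals that of $c$, complemented once if $\sigma$ interchanges the vertical and horizontal directions and complemented once (more) if $\sigma$ is side-reversing. The symmetries form the symmetry group $G_1$, and the side-preserving ones form the side-preserving subgroup $H_1$. A prefabric is isonemal if $G_1$ is transitive on the set of all strands (warps and wefts together). The order of an isonemal prefabric is the period, in cells, of the sequence of over/under crossings along any strand. Thin striping colours the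 warps alternately dark and pale and the wefts alternately dark and pale; the resulting pattern (viewed from the obverse) shows in each cell the colour of the uppermost strand there. The colouring is perfect if every symmetry in $G_1$ either maps all dark strands to dark strands and all pale strands to pale strands, or maps all dark strands to pale strands and all pale strands to dark strands. -}

module Defs where

open import Data.Bool using (Bool; true; false; not; if_then_else_; _xor_)
open import Data.Nat using (ℕ; zero; suc; _<_; _≤_)
open import Data.Integer using (ℤ; +_; -[1+_]; _+_; _-_; _*_; -_)
open import Data.Product using (Σ; _×_; _,_; ∃; ∃-syntax)
open import Data.Sum using (_⊎_)
open import Data.List using (List; []; _∷_; foldr)
open import Data.List.Relation.Unary.All using (All)
open import Relation.Binary.PropositionalEquality using (_≡_; _≢_)
open import Relation.Nullary using (¬_)

-- Cell (i , j) lies in column i (crossed by warp i) and row j (crossed by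
-- weft j).  A design assigns to each cell a colour: true = dark (warp
-- uppermost), false = pale (weft uppermost).  Every design is the design
-- of a unique prefabric, so a prefabric is represented by its design.

Cell : Set
Cell = ℤ × ℤ

Design : Set
Design = ℤ → ℤ → Bool

data Strand : Set where
  warp : ℤ → Strand
  weft : ℤ → Strand

StrandSet : Set
StrandSet = Strand → Bool

Periodic : Design → Set
Periodic D =
  Σ ℤ λ a → Σ ℤ λ b → Σ ℤ λ c → Σ ℤ λ d →
    (a * d - b * c ≢ + 0) ×
    (∀ i j → D (i + a) (j + b) ≡ D i j) ×
    (∀ i j → D (i + c) (j + d) ≡ D i j)

Liftable : Design → StrandSet → Set
Liftable D S =
  (∀ i j → S (warp i) ≡ true → S (weft j) ≡ false → D i j ≡ true) ×
  (∀ i j → S (weft j) ≡ true → S (warp i) ≡ false → D i j ≡ false)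

FallsApart : Design → Set
FallsApart D =
  Σ StrandSet λ S →
    (∃[ s ] S s ≡ true) ×
    (∃[ s ] S s ≡ false) ×
    Liftable D S

Fabric : Design → Set
Fabric D = Periodic D × ¬ FallsApart D

-- Isometries of the plane mapping the grid of cells to itself.
--
-- Such an isometry acts on cell indices as c ↦ A c + s, where A is one of
-- the eight signed permutation matrices and s ∈ ℤ².  A is encoded by
-- swap (whether the two coordinate directions are interchanged) and the
-- signs neg₁, neg₂:
--   swap = false :  (i , j) ↦ (ε₁ i + s₁ , ε₂ j + s₂)
--   swap = true  :  (i , j) ↦ (ε₁ j + s₁ , ε₂ i + s₂)
-- where εₖ = -1 if negₖ, else +1.  The action on cells determines the
-- isometry uniquely.

record Iso : Set where
  constructor iso
  field
    swap : Bool
    neg₁ : Bool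
    neg₂ : Bool
    s₁   : ℤ
    s₂   : ℤ
open Iso public

sgn : Bool → ℤ → ℤ
sgn b x = if b then - x else x

applyIso : Iso → Cell → Cell
applyIso (iso false n₁ n₂ t₁ t₂) (i , j) = (sgn n₁ i + t₁ , sgn n₂ j + t₂)
applyIso (iso true  n₁ n₂ t₁ t₂) (i , j) = (sgn n₁ j + t₁ , sgn n₂ i + t₂)

strandMap : Iso → Strand → Strand
strandMap (iso false n₁ n₂ t₁ t₂) (warp i) = warp (sgn n₁ i + t₁)
strandMap (iso false n₁ n₂ t₁ t₂) (weft j) = weft (sgn n₂ j + t₂)
strandMap (iso true  n₁ n₂ t₁ t₂) (warp i) = weft (sgn n₂ i + t₂)
strandMap (iso true  n₁ n₂ t₁ t₂) (weft j) = warp (sgn n₁ j + t₁)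

-- The linear part is orientation-reversing (determinant -1).
-- det = ε₁ε₂ if no swap, -ε₁ε₂ if swap.
OrientationReversing : Iso → Set
OrientationReversing g = (swap g xor (neg₁ g xor neg₂ g)) ≡ true

-- A glide-reflection: an orientation-reversing isometry that is not a
-- reflection, i.e. whose square (a translation) is not the identity.
GlideReflection : Iso → Set
GlideReflection g =
  OrientationReversing g × ¬ (∀ c → applyIso g (applyIso g c) ≡ c)

-- Symmetries.  `side = true` means side-reversing (combined with τ).
-- Colour of σ(c) equals colour of c, complemented once if σ swaps the
-- directions and once more if σ is side-reversing.

IsSymmetry : Design → Iso → Bool → Set
IsSymmetry D g side =
  ∀ i j → let (i' , j') = applyIso g (i , j) in
          D i' j' ≡ (D i j xor (swap g xor side))

-- membership in G₁ : IsSymmetry D g side for some side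
-- membership in H₁ : IsSymmetry D g false

Isonemal : Design → Set
Isonemal D =
  Periodic D ×
  (∀ s t → Σ Iso λ g → Σ Bool λ side → IsSymmetry D g side × strandMap g s ≡ t)

H₁Transitive : Design → Set
H₁Transitive D = ∀ s t → Σ Iso λ g → IsSymmetry D g false × strandMap g s ≡ t

composeAll : List Iso → Cell → Cell
composeAll gs c = foldr applyIso c gs

-- H₁ is generated by side-preserving glide-reflections: every element of
-- H₁ is a finite product of side-preserving glide-reflections of D
-- (the inverse of a glide-reflection is a glide-reflection).
H₁GeneratedByGlides : Design → Set
H₁GeneratedByGlides D =
  ∀ h → IsSymmetry D h false →
    Σ (List Iso) λ gs →
      All (λ g → GlideReflection g × IsSymmetry D g false) gs ×
      (∀ c → applyIso h c ≡ composeAll gs c)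

-- crossing sequence along a strand: along warp i, cell (i , k) ;
-- along weft j, cell (k , j).  (Value = design colour of the cell; the
-- period is the same as for the over/under sequence of that strand.)
strandSeq : Design → Strand → ℤ → Bool
strandSeq D (warp i) k = D i k
strandSeq D (weft j) k = D k j

HasPeriod : (ℤ → Bool) → ℕ → Set
HasPeriod f p = ∀ k → f (k + + p) ≡ f k

HasOrder : Design → ℕ → Set
HasOrder D n =
  0 < n ×
  (∀ s → HasPeriod (strandSeq D s) n) ×
  (∀ s p → 0 < p → p < n → ¬ HasPeriod (strandSeq D s) p)

oddℕ : ℕ → Bool
oddℕ zero    = false
oddℕ (suc n) = not (oddℕ n)

oddℤ : ℤ → Bool
oddℤ (+ n)      = oddℕ n
oddℤ -[1+ n ]   = not (oddℕ n)

thinStripe : Bool → Bool → Strand → Bool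
thinStripe a b (warp i) = oddℤ i xor a
thinStripe a b (weft j) = oddℤ j xor b

pattern' : Design → (Strand → Bool) → Design
pattern' D col i j = if D i j then col (warp i) else col (weft j)

Perfect : Design → (Strand → Bool) → Set
Perfect D col =
  ∀ g side → IsSymmetry D g side →
    (∀ s → col (strandMap g s) ≡ col s) ⊎
    (∀ s → col (strandMap g s) ≡ not (col s))

module Submission where

-- Idea of the proof.  Let col be a thin striping and P = pattern' D col the
-- pattern it produces.  Two conclusions are needed.
--
-- * P falls apart, for ANY design D and colouring col: the dark warps
--   together with the pale wefts can be lifted off, because wherever such
--   a strand crosses a strand of the complementary set both strands carry
--   the same colour, so P shows that colour.  Thin striping makes this set
--   nonempty and proper (warps 0 and 1 have opposite colours).
--
-- * P is isonemal.  Doubling the two period translations of D gives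
--   translations that also preserve parities, hence periods of P.  For
--   transitivity, a side-preserving symmetry g of D that shifts every
--   strand colour by a fixed f (which a perfect colouring guarantees)
--   shifts every pattern cell colour by f, so g is a symmetry of P (side-
--   reversing exactly when swap g xor f holds).  Transitivity of H₁ on the
--   strands of D therefore transfers to G₁ of P.

open import Defs
open import Data.Bool using (Bool; true; false; not; if_then_else_; _xor_)
open import Data.Bool.Properties
  using (not-involutive; not-distribˡ-xor; xor-identityʳ; xor-same; xor-comm; if-float; if-not)
open import Data.Nat using (ℕ; _<_; zero; suc)
open import Data.Product using (Σ; _×_; _,_)
open import Data.Sum using (inj₁; inj₂)
open import Data.Integer using (ℤ; +_; -[1+_]; _+_; _-_; _*_)
open import Data.Integer.Properties using (+-assoc; +-identityˡ; i*j≡0⇒i≡0∨j≡0)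
open import Data.Integer.Tactic.RingSolver using (solve-∀)
open import Relation.Binary.PropositionalEquality
  using (_≡_; _≢_; refl; sym; trans; cong; cong₂; module ≡-Reasoning)

oddℤ-suc : ∀ x → oddℤ (+ 1 + x) ≡ not (oddℤ x)
oddℤ-suc (+ n)            = refl
oddℤ-suc -[1+ zero ]      = refl
oddℤ-suc -[1+ suc n ]     = sym (not-involutive _)

oddℤ-pred : ∀ x → oddℤ (-[1+ 0 ] + x) ≡ not (oddℤ x)
oddℤ-pred (+ zero)  = refl
oddℤ-pred (+ suc n) = sym (not-involutive _)
oddℤ-pred -[1+ n ]  = refl

oddℤ-+ : ∀ y x → oddℤ (y + x) ≡ oddℤ y xor oddℤ x
oddℤ-+ (+ zero) x = cong oddℤ (+-identityˡ x)
oddℤ-+ (+ suc n) x = begin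
  oddℤ (+ suc n + x)            ≡⟨ cong oddℤ (+-assoc (+ 1) (+ n) x) ⟩
  oddℤ (+ 1 + (+ n + x))        ≡⟨ oddℤ-suc (+ n + x) ⟩
  not (oddℤ (+ n + x))          ≡⟨ cong not (oddℤ-+ (+ n) x) ⟩
  not (oddℤ (+ n) xor oddℤ x)   ≡⟨ not-distribˡ-xor (oddℤ (+ n)) (oddℤ x) ⟩
  oddℤ (+ suc n) xor oddℤ x     ∎
  where open ≡-Reasoning
oddℤ-+ -[1+ zero ] x = oddℤ-pred x
oddℤ-+ -[1+ suc n ] x = begin
  oddℤ (-[1+ suc n ] + x)         ≡⟨ cong oddℤ (+-assoc -[1+ 0 ] -[1+ n ] x) ⟩
  oddℤ (-[1+ 0 ] + (-[1+ n ] + x)) ≡⟨ oddℤ-pred (-[1+ n ] + x) ⟩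
  not (oddℤ (-[1+ n ] + x))       ≡⟨ cong not (oddℤ-+ -[1+ n ] x) ⟩
  not (oddℤ -[1+ n ] xor oddℤ x)  ≡⟨ not-distribˡ-xor (oddℤ -[1+ n ]) (oddℤ x) ⟩
  oddℤ -[1+ suc n ] xor oddℤ x    ∎
  where open ≡-Reasoning

oddℤ-+-even : ∀ x y → oddℤ (x + (y + y)) ≡ oddℤ x
oddℤ-+-even x y = begin
  oddℤ (x + (y + y))               ≡⟨ oddℤ-+ x (y + y) ⟩
  oddℤ x xor oddℤ (y + y)          ≡⟨ cong (oddℤ x xor_) (oddℤ-+ y y) ⟩
  oddℤ x xor (oddℤ y xor oddℤ y)   ≡⟨ cong (oddℤ x xor_) (xor-same (oddℤ y)) ⟩
  oddℤ x xor false                 ≡⟨ xor-identityʳ (oddℤ x) ⟩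
  oddℤ x                           ∎
  where open ≡-Reasoning

darkWarpsPaleWefts : (Strand → Bool) → StrandSet
darkWarpsPaleWefts col (warp i) = col (warp i)
darkWarpsPaleWefts col (weft j) = not (col (weft j))

-- In the pattern of any colouring, the dark warps and pale wefts lie on top
-- of every strand outside that set, since the crossing strands share a colour.
patternLiftable : ∀ D col → Liftable (pattern' D col) (darkWarpsPaleWefts col)
patternLiftable D col = darkWarpOnTop , paleWeftOnTop
  where
  darkWarpOnTop : ∀ i j → col (warp i) ≡ true → not (col (weft j)) ≡ false →
                  pattern' D col i j ≡ true
  darkWarpOnTop i j dark _ with D i j | col (weft j)
  ... | true  | _    = dark
  ... | false | true = refl

  paleWeftOnTop : ∀ i j → not (col (weft j)) ≡ true → col (warp i) ≡ false →
                  pattern' D col i j ≡ false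
  paleWeftOnTop i j _ pale with D i j | col (weft j)
  ... | true  | _     = pale
  ... | false | false = refl

thinStripePatternFallsApart : ∀ D a b → FallsApart (pattern' D (thinStripe a b))
thinStripePatternFallsApart D true b =
  darkWarpsPaleWefts (thinStripe true b) ,
  (warp (+ 0) , refl) , (warp (+ 1) , refl) , patternLiftable D (thinStripe true b)
thinStripePatternFallsApart D false b =
  darkWarpsPaleWefts (thinStripe false b) ,
  (warp (+ 1) , refl) , (warp (+ 0) , refl) , patternLiftable D (thinStripe false b)

doublePeriod : ∀ (D : Design) p q → (∀ i j → D (i + p) (j + q) ≡ D i j) →
               ∀ i j → D (i + (p + p)) (j + (q + q)) ≡ D i j
doublePeriod D p q period i j = begin
  D (i + (p + p)) (j + (q + q))  ≡⟨ cong₂ D (sym (+-assoc i p p)) (sym (+-assoc j q q)) ⟩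
  D (i + p + p) (j + q + q)      ≡⟨ period (i + p) (j + q) ⟩
  D (i + p) (j + q)              ≡⟨ period i j ⟩
  D i j                          ∎
  where open ≡-Reasoning

-- A doubled period of D is a period of the thin-striped pattern, as it also
-- preserves the parities of the strand indices.
patternDoublePeriod : ∀ (D : Design) a b p q → (∀ i j → D (i + p) (j + q) ≡ D i j) →
  ∀ i j → pattern' D (thinStripe a b) (i + (p + p)) (j + (q + q)) ≡ pattern' D (thinStripe a b) i j
patternDoublePeriod D a b p q period i j
  rewrite doublePeriod D p q period i j | oddℤ-+-even i p | oddℤ-+-even j q = refl

det-double : ∀ p q r t → (p + p) * (t + t) - (q + q) * (r + r) ≡ + 4 * (p * t - q * r)
det-double = solve-∀

patternPeriodic : ∀ D a b → Periodic D → Periodic (pattern' D (thinStripe a b))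
patternPeriodic D a b (p , q , r , t , independent , period₁ , period₂) =
  p + p , q + q , r + r , t + t , doubledIndependent ,
  patternDoublePeriod D a b p q period₁ , patternDoublePeriod D a b r t period₂
  where
  doubledIndependent : (p + p) * (t + t) - (q + q) * (r + r) ≢ + 0
  doubledIndependent zeroDet with i*j≡0⇒i≡0∨j≡0 (+ 4) (trans (sym (det-double p q r t)) zeroDet)
  ... | inj₁ ()
  ... | inj₂ det≡0 = independent det≡0

-- The uppermost strand
-- at g(c) is the image of the uppermost strand at c.
patternShift : ∀ D col g f → IsSymmetry D g false →
  (∀ s → col (strandMap g s) ≡ col s xor f) →
  ∀ i j → let (i' , j') = applyIso g (i , j) in
          pattern' D col i' j' ≡ pattern' D col i j xor f
patternShift D col (iso false n₁ n₂ t₁ t₂) f sym-g shift i j = begin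
  (if D i' j' then col (warp i') else col (weft j'))
    ≡⟨ cong₂ (if_then_else_ (D i' j')) (shift (warp i)) (shift (weft j)) ⟩
  (if D i' j' then col (warp i) xor f else col (weft j) xor f)
    ≡⟨ cong (λ d → if d then col (warp i) xor f else col (weft j) xor f)
            (trans (sym-g i j) (xor-identityʳ (D i j))) ⟩
  (if D i j then col (warp i) xor f else col (weft j) xor f)
    ≡⟨ sym (if-float (_xor f) (D i j)) ⟩
  pattern' D col i j xor f ∎
  where
  open ≡-Reasoning
  i' = sgn n₁ i + t₁
  j' = sgn n₂ j + t₂
patternShift D col (iso true n₁ n₂ t₁ t₂) f sym-g shift i j = begin
  (if D i' j' then col (warp i') else col (weft j'))
    ≡⟨ cong₂ (if_then_else_ (D i' j')) (shift (weft j)) (shift (warp i)) ⟩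
  (if D i' j' then col (weft j) xor f else col (warp i) xor f)
    ≡⟨ cong (λ d → if d then col (weft j) xor f else col (warp i) xor f)
            (trans (sym-g i j) (xor-comm (D i j) true)) ⟩
  (if not (D i j) then col (weft j) xor f else col (warp i) xor f)
    ≡⟨ if-not (D i j) ⟩
  (if D i j then col (warp i) xor f else col (weft j) xor f)
    ≡⟨ sym (if-float (_xor f) (D i j)) ⟩
  pattern' D col i j xor f ∎
  where
  open ≡-Reasoning
  i' = sgn n₁ j + t₁
  j' = sgn n₂ i + t₂

patternSymmetry : ∀ D col g f → IsSymmetry D g false →
  (∀ s → col (strandMap g s) ≡ col s xor f) →
  IsSymmetry (pattern' D col) g (swap g xor f)
patternSymmetry D col g f sym-g shift i j = begin
  _                                      ≡⟨ patternShift D col g f sym-g shift i j ⟩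
  pattern' D col i j xor f               ≡⟨ cong (pattern' D col i j xor_) (sym (cancel (swap g) f)) ⟩
  pattern' D col i j xor (swap g xor (swap g xor f)) ∎
  where
  open ≡-Reasoning
  cancel : ∀ x y → x xor (x xor y) ≡ y
  cancel false y = refl
  cancel true  y = not-involutive y

perfectPatternSymmetry : ∀ D col → Perfect D col → ∀ g → IsSymmetry D g false →
  Σ Bool λ side → IsSymmetry (pattern' D col) g side
perfectPatternSymmetry D col perfect g sym-g with perfect g false sym-g
... | inj₁ keeps = _ , patternSymmetry D col g false sym-g
                         (λ s → trans (keeps s) (sym (xor-identityʳ (col s))))
... | inj₂ swaps = _ , patternSymmetry D col g true sym-g
                         (λ s → trans (swaps s) (xor-comm true (col s)))

theorem3p1 : (D : Design) → Fabric D →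
    Σ ℕ (λ n → HasOrder D n × 4 < n) →
    (a b : Bool) → Perfect D (thinStripe a b) →
    H₁GeneratedByGlides D → H₁Transitive D →
    Isonemal (pattern' D (thinStripe a b)) × FallsApart (pattern' D (thinStripe a b))
theorem3p1 D (periodic , _) _ a b perfect _ transitive =
  (patternPeriodic D a b periodic , patternTransitive) , thinStripePatternFallsApart D a b
  where
  patternTransitive : ∀ s t → Σ Iso λ g → Σ Bool λ side →
    IsSymmetry (pattern' D (thinStripe a b)) g side × strandMap g s ≡ t
  patternTransitive s t with transitive s t
  ... | g , sym-g , s↦t with perfectPatternSymmetry D (thinStripe a b) perfect g sym-g
  ...   | side , sym-pattern = g , side , sym-pattern , s↦t
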